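{- Let $x:[t]\to\mathbb{Z}\setminus\{0\}$ be such that $(x(1),\ldots,x(t))$ is generalized Catalan with $2y$ runs, and let $\pi$ be the permutation associated to $x$. Let $1\le i\le y$. If $h\in\Phi_i$ and $x(\pi(h))<0$, then $\sum_{k=1}^h x(\pi(k))\in[0,\alpha_i)$.
   Context: A list $(x_1,\ldots,x_t)$ of nonzero integers is generalized Catalan if $\sum_{i=1}^t x_i=0$ and $\sum_{i=1}^q x_i\ge0$ for all $1\le q\le t$. A run is a maximal block of consecutive entries of the same sign; an up-run consists of positive entries. A generalized Catalan list has $2y$ runs, alternately up- and down-runs, starting with an up-run. $U_i\subset[t]$ is the set of indices of the $i$-th up-run ($1\le i\le y$) and $\alpha_i$ is the maximum entry of the $i$-th up-run. The permutation $\pi$ associated to $x$: $\pi(1)=1$; for $2\le q\le t$, let $s=\min\{i\in[t]: i\notin\{\pi(1),\ldots,\pi(q-1)\},\ x(i)<0\}$ and $s'=\min\{i\in[t]: i\notin\{\pi(1),\ldots,\pi(q-1)\},\ x(i)>0\}$ (minimum of the empty set is $\infty$); then $\pi(q)=s$ if $s<\infty$ and $\sum_{i=1}^{q-1}x(\pi(i))+x(s)\ge0$, and $\pi(q)=s'$ otherwise (this yields a permutation of $[t]$). Let $\gamma_i=\min\{l:\pi(l)\in U_i\}$. The $i$-th up-phase is $\Phi_i=\{\gamma_i,\gamma_i+1,\ldots,\gamma_{i+1}-1\}$ for $i<y$ and $\Phi_y=\{\gamma_y,\ldots,t\}$. -}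

module Defs where

open import Data.Bool using (Bool; true; false; if_then_else_; not; _∧_; _xor_)
open import Data.Nat as ℕ using (ℕ; zero; suc; _∸_)
open import Data.Integer using (ℤ; 0ℤ; _+_; _≤_; _<_; _⊔_; _≤?_; _<?_)
open import Data.List using (List; []; _∷_; _++_; map; upTo; filterᵇ; head; take; length; foldr)
open import Data.Bool.ListAction using (any)
open import Data.Maybe using (Maybe; just; nothing)
open import Data.Product using (_×_)
open import Relation.Nullary.Decidable using (⌊_⌋)
open import Relation.Binary.PropositionalEquality using (_≡_; _≢_)

-- 1-based access x(i); junk value 0 outside 1..t.
xAt : List ℤ → ℕ → ℤ
xAt []       _             = 0ℤ
xAt (a ∷ as) zero          = 0ℤ
xAt (a ∷ as) (suc zero)    = a
xAt (a ∷ as) (suc (suc n)) = xAt as (suc n)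

range1 : ℕ → List ℕ
range1 n = map suc (upTo n)

sumℤ : List ℤ → ℤ
sumℤ = foldr _+_ 0ℤ

Σ1to : ℕ → (ℕ → ℤ) → ℤ
Σ1to q f = sumℤ (map f (range1 q))

IsGenCatalan : List ℤ → Set
IsGenCatalan xs =
  (∀ i → 1 ℕ.≤ i → i ℕ.≤ length xs → xAt xs i ≢ 0ℤ)
  × Σ1to (length xs) (xAt xs) ≡ 0ℤ
  × (∀ q → 1 ℕ.≤ q → q ℕ.≤ length xs → 0ℤ ≤ Σ1to q (xAt xs))

isPos : ℤ → Bool
isPos a = ⌊ 0ℤ <? a ⌋

isNeg : ℤ → Bool
isNeg a = ⌊ a <? 0ℤ ⌋

signChanges : List ℤ → ℕ
signChanges []           = 0
signChanges (a ∷ [])     = 0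
signChanges (a ∷ b ∷ cs) =
  (if isPos a xor isPos b then 1 else 0) ℕ.+ signChanges (b ∷ cs)

numRuns : List ℤ → ℕ
numRuns []       = 0
numRuns (a ∷ as) = suc (signChanges (a ∷ as))

runOf : List ℤ → ℕ → ℕ
runOf xs j = suc (signChanges (take j xs))

-- j ∈ U_i : j lies in the i-th up-run, i.e. in the (2i-1)-th run
-- (runs alternate starting with an up-run), and x(j) > 0.
inUᵇ : List ℤ → ℕ → ℕ → Bool
inUᵇ xs i j =
  ⌊ 1 ℕ.≤? j ⌋ ∧ ⌊ j ℕ.≤? length xs ⌋ ∧ isPos (xAt xs j)
  ∧ ⌊ runOf xs j ℕ.≟ (2 ℕ.* i ∸ 1) ⌋

U : List ℤ → ℕ → List ℕ
U xs i = filterᵇ (inUᵇ xs i) (range1 (length xs))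

α : List ℤ → ℕ → ℤ
α xs i with map (xAt xs) (U xs i)
... | []       = 0ℤ
... | (a ∷ as) = foldr _⊔_ a as

firstUnused : List ℤ → (ℤ → Bool) → List ℕ → Maybe ℕ
firstUnused xs p used =
  head (filterᵇ (λ i → not (any (λ u → ⌊ u ℕ.≟ i ⌋) used) ∧ p (xAt xs i))
                (range1 (length xs)))

-- given [π(1),...,π(q-1)], compute π(q)   (q ≥ 2)
nextπ : List ℤ → List ℕ → ℕ
nextπ xs used with firstUnused xs isNeg used | firstUnused xs isPos used
... | just s  | s' with ⌊ 0ℤ ≤? (sumℤ (map (xAt xs) used) + xAt xs s) ⌋
...   | true  = s
...   | false = fromMaybe0 s'
  where fromMaybe0 : Maybe ℕ → ℕ
        fromMaybe0 (just n) = n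
        fromMaybe0 nothing  = 0
nextπ xs used | nothing | just s' = s'
nextπ xs used | nothing | nothing = 0   -- junk (never reached for q ≤ t)

πPrefix : List ℤ → ℕ → List ℕ
πPrefix xs zero          = []
πPrefix xs (suc zero)    = 1 ∷ []
πPrefix xs (suc (suc q)) = let p = πPrefix xs (suc q) in p ++ (nextπ xs p ∷ [])

nthℕ : List ℕ → ℕ → ℕ
nthℕ []       _             = 0
nthℕ (a ∷ as) zero          = 0
nthℕ (a ∷ as) (suc zero)    = a
nthℕ (a ∷ as) (suc (suc n)) = nthℕ as (suc n)

π : List ℤ → ℕ → ℕ
π xs q = nthℕ (πPrefix xs (length xs)) q

-- γ_i = min { l : π(l) ∈ U_i }   (junk value t+1 if no such l)
γ : List ℤ → ℕ → ℕ
γ xs i with head (filterᵇ (λ l → inUᵇ xs i (π xs l)) (range1 (length xs)))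
... | just l  = l
... | nothing = suc (length xs)

-- h ∈ Φ_i  (y = half the number of runs):
--   Φ_i = {γ_i, ..., γ_{i+1} - 1} for i < y,  Φ_y = {γ_y, ..., t}
InΦ : List ℤ → ℕ → ℕ → ℕ → Set
InΦ xs y i h =
  γ xs i ℕ.≤ h
  × (i ℕ.< y → h ℕ.< γ xs (suc i))
  × (i ≡ y → h ℕ.≤ length xs)

{-# OPTIONS --safe #-}
module Submission where

-- The prefix sums S q = x(π 1) + ⋯ + x(π q) never become negative: π takes the first unused
-- negative entry only when the sum stays non-negative. For the upper bound, let p be the last
-- step before h taking a positive entry. That step was forced because the first unused
-- negative entry s did not fit, and s is taken right after, so S (p + 1) = (S (p - 1) + x s) +
-- x(π p) < x(π p); the steps from p + 2 to h take non-positive entries. Finally π p still lies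
-- in the i-th up-run: positive entries are taken in increasing order of index, so if π p lay
-- further right, the first entry of the (i+1)-th up-run would already have been taken at a
-- step ≤ p < h, contradicting h < γ(i+1) (and for i = y there is no (i+1)-th up-run).
-- Hence S h < x(π p) ≤ α i.

open import Defs
open import Data.Nat using (ℕ; _≤_; _*_)
open import Data.Integer using (ℤ; 0ℤ; _<_)
import Data.Integer
open import Data.List using (List; length)
open import Data.Product using (_×_)
open import Relation.Binary.PropositionalEquality using (_≡_)

open import Data.Bool using (Bool; true; false; T; not; _∧_; _xor_; if_then_else_)
open import Data.Bool.ListAction using (any)
open import Data.Bool.Properties using (T-≡)
import Data.Integer as ℤ
open import Data.Integer using (_+_)
import Data.Integer.Properties as ZP
open import Algebra.Properties.CommutativeSemigroup ZP.+-commutativeSemigroup using (xy∙z≈xz∙y)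
import Data.Nat as ℕ
open import Data.Nat using (zero; suc; z≤n; s≤s; _∸_)
open import Data.Nat.Properties
  using ( ≤-refl; ≤-reflexive; ≤-trans; ≤-antisym; ≤-pred; <-trans; <-≤-trans; <-irrefl; <-cmp
        ; <⇒≤; <⇒≱; ≤⇒≯; ≰⇒>; ≮⇒≥; ≤∧≢⇒<; m≤n⇒m<n∨m≡n; n≤0⇒n≡0; n≤1+n; n<1+n; m<n⇒m<1+n
        ; m≤n⇒m≤1+n; m≤m+n; _≤?_; +-monoʳ-≤; +-identityʳ; +-assoc; +-comm; *-suc; *-monoʳ-≤
        ; suc-injective; module ≤-Reasoning )
open import Data.List using ([]; _∷_; _++_; _∷ʳ_; map; upTo; filterᵇ; head; take; foldr)
open import Data.List.Properties using (map-++; upTo-∷ʳ; filter-++; length-map; length-upTo)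
open import Data.List.Membership.Propositional using (_∈_; _∉_)
open import Data.List.Membership.Propositional.Properties
  using (∈-map⁺; ∈-map⁻; ∈-upTo⁺; ∈-upTo⁻; ∈-++⁻; ∈-filter⁺)
open import Data.List.Membership.DecPropositional ℕ._≟_ using (_∈?_)
import Data.List.Relation.Unary.Any as Any
open import Data.List.Relation.Unary.Any using (here; there)
open import Data.List.Relation.Unary.Any.Properties using (any⁺; any⁻)
open import Data.Maybe using (Maybe; just; nothing)
open import Data.Maybe.Properties using (just-injective)
open import Data.Product using (_,_; ∃; proj₁; proj₂)
open import Data.Sum using (_⊎_; inj₁; inj₂)
open import Function using (_∘_; id)
open import Function.Bundles using (Equivalence; _⇔_; mk⇔)
open import Relation.Binary.Definitions using (tri<; tri≈; tri>)
open import Relation.Binary.PropositionalEquality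
  using (_≢_; refl; sym; trans; cong; cong₂; subst; module ≡-Reasoning)
open import Relation.Nullary using (¬_; contradiction; yes; no)
open import Relation.Nullary.Decidable using (T?; toWitness; fromWitness; ⌊_⌋)
open import Relation.Unary using (Decidable)

range1-∷ʳ : ∀ n → range1 (suc n) ≡ range1 n ∷ʳ suc n
range1-∷ʳ n = begin
  map suc (upTo (suc n)) ≡⟨ cong (map suc) (upTo-∷ʳ n) ⟨
  map suc (upTo n ∷ʳ n)  ≡⟨ map-++ suc (upTo n) (n ∷ []) ⟩
  range1 n ∷ʳ suc n      ∎
  where open ≡-Reasoning

∈-range1⁺ : ∀ {n j} → 1 ≤ j → j ≤ n → j ∈ range1 n
∈-range1⁺ {j = suc j} _ j<n = ∈-map⁺ suc (∈-upTo⁺ j<n)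

∈-range1⁻ : ∀ {n j} → j ∈ range1 n → 1 ≤ j × j ≤ n
∈-range1⁻ j∈ with _ , i∈ , refl ← ∈-map⁻ suc j∈ = s≤s z≤n , ∈-upTo⁻ i∈

record Least (g : ℕ → Bool) (n s : ℕ) : Set where
  field
    lower   : 1 ≤ s
    upper   : s ≤ n
    holds   : T (g s)
    minimal : ∀ {j} → 1 ≤ j → j ℕ.< s → ¬ T (g j)

Least-unique : ∀ {g n s s′} → Least g n s → Least g n s′ → s ≡ s′
Least-unique {s = s} {s′} l l′ with <-cmp s s′
... | tri< s<s′ _ _ = contradiction (Least.holds l) (Least.minimal l′ (Least.lower l) s<s′)
... | tri≈ _ s≡s′ _ = s≡s′
... | tri> _ _ s′<s = contradiction (Least.holds l′) (Least.minimal l (Least.lower l′) s′<s)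

Least-weaken : ∀ {g n m s} → n ≤ m → Least g n s → Least g m s
Least-weaken n≤m l = record
  { lower = lower ; upper = ≤-trans upper n≤m ; holds = holds ; minimal = minimal }
  where open Least l

Least-⊆ : ∀ {g g′ n s} → (∀ {j} → T (g′ j) → T (g j)) → Least g n s → T (g′ s) → Least g′ n s
Least-⊆ g′⊆g l g′s = record
  { lower = lower ; upper = upper ; holds = g′s ; minimal = λ 1≤j j<s → minimal 1≤j j<s ∘ g′⊆g }
  where open Least l

data FirstIn (g : ℕ → Bool) (n : ℕ) : Maybe ℕ → Set where
  none  : (∀ {j} → 1 ≤ j → j ≤ n → ¬ T (g j)) → FirstIn g n nothing
  found : ∀ {s} → Least g n s → FirstIn g n (just s)

firstIn : ∀ g n → FirstIn g n (head (filterᵇ g (range1 n)))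
firstIn g zero    = none λ 1≤j j≤0 → contradiction (≤-trans 1≤j j≤0) λ ()
firstIn g (suc n) =
  subst (FirstIn g (suc n)) (sym (cong head split)) (extend (filterᵇ g (range1 n)) (firstIn g n))
  where
  split : filterᵇ g (range1 (suc n)) ≡ filterᵇ g (range1 n) ++ filterᵇ g (suc n ∷ [])
  split = trans (cong (filterᵇ g) (range1-∷ʳ n)) (filter-++ (T? ∘ g) (range1 n) (suc n ∷ []))

  extend : ∀ l → FirstIn g n (head l) → FirstIn g (suc n) (head (l ++ filterᵇ g (suc n ∷ [])))
  extend (_ ∷ _) (found l)      = found (Least-weaken (n≤1+n n) l)
  extend []      (none never≤n) with g (suc n) in g[1+n]
  ... | true  = found record
    { lower = s≤s z≤n ; upper = ≤-refl ; holds = subst T (sym g[1+n]) _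
    ; minimal = λ 1≤j j≤n → never≤n 1≤j (≤-pred j≤n) }
  ... | false = none never≤1+n
    where
    never≤1+n : ∀ {j} → 1 ≤ j → j ≤ suc n → ¬ T (g j)
    never≤1+n {j} 1≤j j≤1+n with m≤n⇒m<n∨m≡n j≤1+n
    ... | inj₁ j<1+n = never≤n 1≤j (≤-pred j<1+n)
    ... | inj₂ refl  = subst T g[1+n]

firstIn-≡ : ∀ {g n m} → head (filterᵇ g (range1 n)) ≡ m → FirstIn g n m
firstIn-≡ {g} {n} eq = subst (FirstIn g n) eq (firstIn g n)

head-filterᵇ-range1-⊆-nothing : ∀ {g g′ n} → (∀ {j} → T (g′ j) → T (g j)) →
  head (filterᵇ g (range1 n)) ≡ nothing → head (filterᵇ g′ (range1 n)) ≡ nothing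
head-filterᵇ-range1-⊆-nothing {g} {g′} {n} g′⊆g eq
  with firstIn-≡ eq | head (filterᵇ g′ (range1 n)) | firstIn g′ n
... | _          | nothing | _       = refl
... | none never | just _  | found l =
  contradiction (g′⊆g (Least.holds l)) (never (Least.lower l) (Least.upper l))

head-filterᵇ-range1-⊆-just : ∀ {g g′ n s} → (∀ {j} → T (g′ j) → T (g j)) →
  head (filterᵇ g (range1 n)) ≡ just s → T (g′ s) → head (filterᵇ g′ (range1 n)) ≡ just s
head-filterᵇ-range1-⊆-just {g} {g′} {n} g′⊆g eq g′s
  with firstIn-≡ eq | head (filterᵇ g′ (range1 n)) | firstIn g′ n
... | found l | nothing | none never = contradiction g′s (never (Least.lower l) (Least.upper l))
... | found l | just _  | found l′   = cong just (Least-unique l′ (Least-⊆ g′⊆g l g′s))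

module _ {a ℓ} {A : Set a} (_≼_ : A → A → Set ℓ)
         (≼-refl : ∀ {u} → u ≼ u) (≼-trans : ∀ {u v w} → u ≼ v → v ≼ w → u ≼ w) (f : ℕ → A) where

  chain-by-steps : ∀ {a b} → (∀ {k} → a ≤ k → k ℕ.< b → f k ≼ f (suc k)) → a ≤ b → f a ≼ f b
  chain-by-steps {a} {zero}  step a≤0 with refl ← n≤0⇒n≡0 a≤0 = ≼-refl
  chain-by-steps {a} {suc b} step a≤1+b with m≤n⇒m<n∨m≡n a≤1+b
  ... | inj₂ refl  = ≼-refl
  ... | inj₁ a<1+b = ≼-trans (chain-by-steps (λ a≤k k<b → step a≤k (m<n⇒m<1+n k<b)) (≤-pred a<1+b))
                             (step (≤-pred a<1+b) ≤-refl)

discrete-ivt : ∀ (f : ℕ → ℕ) {a b c} → (∀ {k} → a ≤ k → k ℕ.< b → f (suc k) ≤ suc (f k)) →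
  a ≤ b → f a ≤ c → c ≤ f b → ∃ λ j → a ≤ j × j ≤ b × f j ≡ c
discrete-ivt f {a} {zero} step a≤0 fa≤c c≤fb with refl ← n≤0⇒n≡0 a≤0 =
  0 , z≤n , z≤n , ≤-antisym fa≤c c≤fb
discrete-ivt f {a} {suc b} {c} step a≤1+b fa≤c c≤fb with m≤n⇒m<n∨m≡n a≤1+b
... | inj₂ refl  = a , ≤-refl , ≤-refl , ≤-antisym fa≤c c≤fb
... | inj₁ a<1+b with c ≤? f b
...   | yes c≤fb′ =
  let j , a≤j , j≤b , fj≡c =
        discrete-ivt f (λ a≤k k<b → step a≤k (m<n⇒m<1+n k<b)) (≤-pred a<1+b) fa≤c c≤fb′
  in j , a≤j , m≤n⇒m≤1+n j≤b , fj≡c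
...   | no c≰fb =
  suc b , <⇒≤ a<1+b , ≤-refl , ≤-antisym (≤-trans (step (≤-pred a<1+b) ≤-refl) (≰⇒> c≰fb)) c≤fb

record Greatest (P : ℕ → Set) (g h p : ℕ) : Set where
  field
    lower   : g ≤ p
    upper   : p ℕ.< h
    holds   : P p
    maximal : ∀ {k} → p ℕ.< k → k ℕ.< h → ¬ P k

greatest : ∀ {P : ℕ → Set} → Decidable P → ∀ {g h} → g ℕ.< h → P g → ∃ (Greatest P g h)
greatest {P} P? {g} {suc h} g<1+h Pg with P? h
... | yes Ph = h , record { lower = ≤-pred g<1+h ; upper = ≤-refl ; holds = Ph
                          ; maximal = λ h<k k<1+h → contradiction (≤-pred k<1+h) (<⇒≱ h<k) }
... | no ¬Ph with m≤n⇒m<n∨m≡n (≤-pred g<1+h)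
...   | inj₂ refl = contradiction Pg ¬Ph
...   | inj₁ g<h with p , G ← greatest P? g<h Pg =
  p , record { lower = lower ; upper = m<n⇒m<1+n upper ; holds = holds ; maximal = maximal′ }
  where
  open Greatest G
  maximal′ : ∀ {k} → p ℕ.< k → k ℕ.< suc h → ¬ P k
  maximal′ p<k k<1+h with m≤n⇒m<n∨m≡n (≤-pred k<1+h)
  ... | inj₁ k<h  = maximal p<k k<h
  ... | inj₂ refl = ¬Ph

isPos⁺ : ∀ {a} → 0ℤ < a → isPos a ≡ true
isPos⁺ a>0 = Equivalence.to T-≡ (fromWitness a>0)

isPos⁻ : ∀ {a} → isPos a ≡ true → 0ℤ < a
isPos⁻ e = toWitness (Equivalence.from T-≡ e)

signChange : ℤ → ℤ → ℕ
signChange a b = if isPos a xor isPos b then 1 else 0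

-- The run containing j, counted from 0: runOf xs j ≡ suc (changes xs j).
changes : List ℤ → ℕ → ℕ
changes xs j = signChanges (take j xs)

changes-suc : ∀ xs {j} → 1 ≤ j → j ℕ.< length xs →
  changes xs (suc j) ≡ changes xs j ℕ.+ signChange (xAt xs j) (xAt xs (suc j))
changes-suc (a ∷ [])     {1}           _ (s≤s ())
changes-suc (a ∷ b ∷ cs) {1}           _ _        = +-identityʳ (signChange a b)
changes-suc (a ∷ b ∷ cs) {suc (suc j)} _ (s≤s j<) = begin
  signChange a b ℕ.+ changes (b ∷ cs) (suc (suc j))
    ≡⟨ cong (signChange a b ℕ.+_) (changes-suc (b ∷ cs) (s≤s z≤n) j<) ⟩
  signChange a b ℕ.+ (changes (b ∷ cs) (suc j) ℕ.+ _)
    ≡⟨ +-assoc (signChange a b) _ _ ⟨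
  signChange a b ℕ.+ changes (b ∷ cs) (suc j) ℕ.+ _
    ∎
  where open ≡-Reasoning

signChange≤1 : ∀ a b → signChange a b ≤ 1
signChange≤1 a b with isPos a xor isPos b
... | true  = ≤-refl
... | false = z≤n

changes-step≤1 : ∀ xs {j} → 1 ≤ j → j ℕ.< length xs → changes xs (suc j) ≤ suc (changes xs j)
changes-step≤1 xs {j} 1≤j j<t = begin
  changes xs (suc j)   ≡⟨ changes-suc xs 1≤j j<t ⟩
  changes xs j ℕ.+ _   ≤⟨ +-monoʳ-≤ _ (signChange≤1 (xAt xs j) (xAt xs (suc j))) ⟩
  changes xs j ℕ.+ 1   ≡⟨ +-comm _ 1 ⟩
  suc (changes xs j)   ∎
  where open ≤-Reasoning

changes-monotone : ∀ xs {a b} → 1 ≤ a → a ≤ b → b ≤ length xs → changes xs a ≤ changes xs b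
changes-monotone xs 1≤a a≤b b≤t = chain-by-steps _≤_ ≤-refl ≤-trans (changes xs) step a≤b
  where
  step : ∀ {k} → _ ≤ k → k ℕ.< _ → changes xs k ≤ changes xs (suc k)
  step a≤k k<b = ≤-trans (m≤m+n _ _)
    (≤-reflexive (sym (changes-suc xs (≤-trans 1≤a a≤k) (<-≤-trans k<b b≤t))))

changes≤signChanges : ∀ xs j → changes xs j ≤ signChanges xs
changes≤signChanges []           zero          = z≤n
changes≤signChanges []           (suc j)       = z≤n
changes≤signChanges (a ∷ [])     zero          = z≤n
changes≤signChanges (a ∷ [])     (suc zero)    = z≤n
changes≤signChanges (a ∷ [])     (suc (suc j)) = z≤n
changes≤signChanges (a ∷ b ∷ cs) zero          = z≤n
changes≤signChanges (a ∷ b ∷ cs) (suc zero)    = z≤n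
changes≤signChanges (a ∷ b ∷ cs) (suc (suc j)) =
  +-monoʳ-≤ (signChange a b) (changes≤signChanges (b ∷ cs) (suc j))

isEven : ℕ → Bool
isEven zero    = true
isEven (suc n) = not (isEven n)

isEven-double : ∀ k → isEven (2 * k) ≡ true
isEven-double zero    = refl
isEven-double (suc k) = trans (cong isEven (*-suc 2 k)) (cong (not ∘ not) (isEven-double k))

isEven-+-signChange : ∀ n a b → isEven n ≡ isPos a → isEven (n ℕ.+ signChange a b) ≡ isPos b
isEven-+-signChange n a b even≡ with isPos a | isPos b
... | true  | true  rewrite +-identityʳ n = even≡
... | false | false rewrite +-identityʳ n = even≡
... | true  | false rewrite +-comm n 1    = cong not even≡
... | false | true  rewrite +-comm n 1    = cong not even≡

isPos≡isEven-changes : ∀ xs → 0ℤ < xAt xs 1 → ∀ {j} → 1 ≤ j → j ≤ length xs →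
  isPos (xAt xs j) ≡ isEven (changes xs j)
isPos≡isEven-changes (a ∷ _) a>0  {1}           _ _   = isPos⁺ a>0
isPos≡isEven-changes xs      x₁>0 {suc (suc j)} _ j<t = sym (begin
  isEven (changes xs (suc (suc j)))
    ≡⟨ cong isEven (changes-suc xs (s≤s z≤n) j<t) ⟩
  isEven (changes xs (suc j) ℕ.+ signChange (xAt xs (suc j)) (xAt xs (suc (suc j))))
    ≡⟨ isEven-+-signChange (changes xs (suc j)) (xAt xs (suc j)) (xAt xs (suc (suc j)))
         (sym (isPos≡isEven-changes xs x₁>0 (s≤s z≤n) (<⇒≤ j<t))) ⟩
  isPos (xAt xs (suc (suc j)))
    ∎)
  where open ≡-Reasoning

-- Indexed from 0: InUpRun xs k j means j ∈ U xs (suc k), i.e. j lies in the (2k+1)-th run.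
record InUpRun (xs : List ℤ) (k j : ℕ) : Set where
  field
    lower    : 1 ≤ j
    upper    : j ≤ length xs
    positive : 0ℤ < xAt xs j
    changes≡ : changes xs j ≡ 2 * k

2*suc∸1 : ∀ k → 2 * suc k ∸ 1 ≡ suc (2 * k)
2*suc∸1 k = cong (_∸ 1) (*-suc 2 k)

inUᵇ⇔InUpRun : ∀ xs {k j} → T (inUᵇ xs (suc k) j) ⇔ InUpRun xs k j
inUᵇ⇔InUpRun xs {k} = mk⇔ decode encode
  where
  decode : ∀ {j} → T (inUᵇ xs (suc k) j) → InUpRun xs k j
  decode {j} _
    with 1 ℕ.≤? j | j ℕ.≤? length xs | 0ℤ ℤ.<? xAt xs j | runOf xs j ℕ.≟ 2 * suc k ∸ 1
  ... | yes 1≤j | yes j≤t | yes pos | yes run = record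
    { lower = 1≤j ; upper = j≤t ; positive = pos ; changes≡ = suc-injective (trans run (2*suc∸1 k)) }

  encode : ∀ {j} → InUpRun xs k j → T (inUᵇ xs (suc k) j)
  encode {j} record { lower = 1≤j ; upper = j≤t ; positive = pos ; changes≡ = c≡ }
    with 1 ℕ.≤? j | j ℕ.≤? length xs | 0ℤ ℤ.<? xAt xs j | runOf xs j ℕ.≟ 2 * suc k ∸ 1
  ... | yes _ | yes _ | yes _ | yes _ = _
  ... | no ¬p | _     | _     | _     = ¬p 1≤j
  ... | yes _ | no ¬p | _     | _     = ¬p j≤t
  ... | yes _ | yes _ | no ¬p | _     = ¬p pos
  ... | yes _ | yes _ | yes _ | no ¬p = ¬p (trans (cong suc c≡) (sym (2*suc∸1 k)))

next-up-run : ∀ xs {k a b} → 0ℤ < xAt xs 1 → InUpRun xs k a → a ≤ b → b ≤ length xs →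
  0ℤ < xAt xs b → InUpRun xs k b ⊎ ∃ λ j → a ≤ j × j ≤ b × InUpRun xs (suc k) j
next-up-run xs {k} {a} {b} x₁>0 a∈ a≤b b≤t xb>0 with changes xs b ℕ.≟ 2 * k
... | yes cb≡ =
  inj₁ record { lower = ≤-trans lower a≤b ; upper = b≤t ; positive = xb>0 ; changes≡ = cb≡ }
  where open InUpRun a∈
... | no cb≢ =
  let j , a≤j , j≤b , cj≡ = discrete-ivt (changes xs)
        (λ a≤k k<b → changes-step≤1 xs (≤-trans lower a≤k) (<-≤-trans k<b b≤t)) a≤b
        (subst (_≤ 2 * suc k) (sym changes≡) (*-monoʳ-≤ 2 (n≤1+n k))) past-run
      1≤j = ≤-trans lower a≤j
      j≤t = ≤-trans j≤b b≤t
  in inj₂ (j , a≤j , j≤b , record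
       { lower = 1≤j ; upper = j≤t ; changes≡ = cj≡
       ; positive = isPos⁻ (trans (isPos≡isEven-changes xs x₁>0 1≤j j≤t)
                                  (trans (cong isEven cj≡) (isEven-double (suc k)))) })
  where
  open InUpRun a∈
  2k<cb : 2 * k ℕ.< changes xs b
  2k<cb = ≤∧≢⇒< (subst (_≤ changes xs b) changes≡ (changes-monotone xs lower a≤b b≤t)) (cb≢ ∘ sym)
  cb-even : isEven (changes xs b) ≡ true
  cb-even = trans (sym (isPos≡isEven-changes xs x₁>0 (≤-trans lower a≤b) b≤t)) (isPos⁺ xb>0)
  past-run : 2 * suc k ≤ changes xs b
  past-run with m≤n⇒m<n∨m≡n 2k<cb
  ... | inj₁ 2k+1<cb = subst (_≤ changes xs b) (sym (*-suc 2 k)) 2k+1<cb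
  ... | inj₂ 2k+1≡cb = contradiction
          (trans (sym (cong not (isEven-double k))) (trans (cong isEven 2k+1≡cb) cb-even)) λ ()

no-up-run-beyond : ∀ xs {y j} → numRuns xs ≡ 2 * y → ¬ InUpRun xs y j
no-up-run-beyond []          _    r = contradiction (≤-trans lower upper) λ ()
  where open InUpRun r
no-up-run-beyond xs@(_ ∷ _) {j = j} runs r =
  <-irrefl refl (subst (_≤ signChanges xs) (trans changes≡ (sym runs)) (changes≤signChanges xs j))
  where open InUpRun r

sumℤ-∷ʳ : ∀ l v → sumℤ (l ∷ʳ v) ≡ sumℤ l + v
sumℤ-∷ʳ []      v = trans (ZP.+-identityʳ v) (sym (ZP.+-identityˡ v))
sumℤ-∷ʳ (a ∷ l) v = trans (cong (a +_) (sumℤ-∷ʳ l v)) (sym (ZP.+-assoc a (sumℤ l) v))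

Σ1to-suc : ∀ h f → Σ1to (suc h) f ≡ Σ1to h f + f (suc h)
Σ1to-suc h f = begin
  sumℤ (map f (range1 (suc h)))        ≡⟨ cong (sumℤ ∘ map f) (range1-∷ʳ h) ⟩
  sumℤ (map f (range1 h ∷ʳ suc h))     ≡⟨ cong sumℤ (map-++ f (range1 h) (suc h ∷ [])) ⟩
  sumℤ (map f (range1 h) ∷ʳ f (suc h)) ≡⟨ sumℤ-∷ʳ (map f (range1 h)) (f (suc h)) ⟩
  Σ1to h f + f (suc h)                 ∎
  where open ≡-Reasoning

+-neg-< : ∀ a {b} → b < 0ℤ → a + b < a
+-neg-< a b<0 = subst (a + _ <_) (ZP.+-identityʳ a) (ZP.+-monoʳ-< a b<0)

+-nonpos-≤ : ∀ a {b} → b ℤ.≤ 0ℤ → a + b ℤ.≤ a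
+-nonpos-≤ a b≤0 = subst (a + _ ℤ.≤_) (ZP.+-identityʳ a) (ZP.+-monoʳ-≤ a b≤0)

xAt-zero : ∀ xs → xAt xs 0 ≡ 0ℤ
xAt-zero []      = refl
xAt-zero (_ ∷ _) = refl

xAt-support : ∀ xs {j} → xAt xs j ≢ 0ℤ → 1 ≤ j × j ≤ length xs
xAt-support []       {j}           x≢0 = contradiction refl x≢0
xAt-support (a ∷ as) {zero}        x≢0 = contradiction refl x≢0
xAt-support (a ∷ as) {suc zero}    _   = ≤-refl , s≤s z≤n
xAt-support (a ∷ as) {suc (suc j)} x≢0 = s≤s z≤n , s≤s (proj₂ (xAt-support as x≢0))

nthℕ-support : ∀ (l : List ℕ) {q} → nthℕ l q ≢ 0 → 1 ≤ q × q ≤ length l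
nthℕ-support []      {q}           nth≢0 = contradiction refl nth≢0
nthℕ-support (a ∷ l) {zero}        nth≢0 = contradiction refl nth≢0
nthℕ-support (a ∷ l) {suc zero}    _     = ≤-refl , s≤s z≤n
nthℕ-support (a ∷ l) {suc (suc q)} nth≢0 = s≤s z≤n , s≤s (proj₂ (nthℕ-support l nth≢0))

nthℕ-∷ʳ-length : ∀ (l : List ℕ) a → nthℕ (l ∷ʳ a) (suc (length l)) ≡ a
nthℕ-∷ʳ-length []          a = refl
nthℕ-∷ʳ-length (b ∷ [])    a = refl
nthℕ-∷ʳ-length (b ∷ c ∷ l) a = nthℕ-∷ʳ-length (c ∷ l) a

nthℕ-∷ʳ-< : ∀ (l : List ℕ) a {q} → 1 ≤ q → q ≤ length l → nthℕ (l ∷ʳ a) q ≡ nthℕ l q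
nthℕ-∷ʳ-< (b ∷ l)     a {1}           _ _        = refl
nthℕ-∷ʳ-< (b ∷ c ∷ l) a {suc (suc q)} _ (s≤s q≤) = nthℕ-∷ʳ-< (c ∷ l) a (s≤s z≤n) q≤

γ-least : ∀ xs i → γ xs i ≤ length xs → Least (λ l → inUᵇ xs i (π xs l)) (length xs) (γ xs i)
γ-least xs i γ≤t with head (filterᵇ (λ l → inUᵇ xs i (π xs l)) (range1 (length xs)))
                    | firstIn (λ l → inUᵇ xs i (π xs l)) (length xs)
... | just _  | found l = l
... | nothing | _       = contradiction γ≤t (<-irrefl refl)

γ-minimal : ∀ xs i {l} → 1 ≤ l → l ≤ length xs → T (inUᵇ xs i (π xs l)) → γ xs i ≤ l
γ-minimal xs i {l} 1≤l l≤t inU with head (filterᵇ (λ l → inUᵇ xs i (π xs l)) (range1 (length xs)))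
                                  | firstIn (λ l → inUᵇ xs i (π xs l)) (length xs)
... | just _  | found least = ≮⇒≥ λ l<γ → Least.minimal least 1≤l l<γ inU
... | nothing | none never  = contradiction inU (never 1≤l l≤t)

∈⇒≤-foldr-⊔ : ∀ {v} a as → v ∈ a ∷ as → v ℤ.≤ foldr ℤ._⊔_ a as
∈⇒≤-foldr-⊔ a []       (here refl)         = ZP.≤-refl
∈⇒≤-foldr-⊔ a (b ∷ bs) (here refl)         = ZP.≤-trans (∈⇒≤-foldr-⊔ a bs (here refl)) (ZP.i≤j⊔i b _)
∈⇒≤-foldr-⊔ a (b ∷ bs) (there (here refl)) = ZP.i≤i⊔j b _
∈⇒≤-foldr-⊔ a (b ∷ bs) (there (there v∈)) = ZP.≤-trans (∈⇒≤-foldr-⊔ a bs (there v∈)) (ZP.i≤j⊔i b _)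

≤-α : ∀ xs {k j} → InUpRun xs k j → xAt xs j ℤ.≤ α xs (suc k)
≤-α xs {k} {j} r with map (xAt xs) (U xs (suc k)) | xj∈U
  where
  xj∈U : xAt xs j ∈ map (xAt xs) (U xs (suc k))
  xj∈U = ∈-map⁺ (xAt xs) (∈-filter⁺ (T? ∘ inUᵇ xs (suc k)) (∈-range1⁺ lower upper)
                                    (Equivalence.from (inUᵇ⇔InUpRun xs) r))
    where open InUpRun r
... | []     | ()
... | a ∷ as | xj∈ = ∈⇒≤-foldr-⊔ a as xj∈

catalan-head-positive : ∀ xs → IsGenCatalan xs → 1 ≤ length xs → 0ℤ < xAt xs 1
catalan-head-positive xs@(a ∷ _) (nonzero , _ , prefix-nonneg) 1≤t = ZP.≤∧≢⇒<
  (subst (0ℤ ℤ.≤_) (ZP.+-identityʳ a) (prefix-nonneg 1 ≤-refl 1≤t)) (nonzero 1 ≤-refl 1≤t ∘ sym)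

module Picking (xs : List ℤ) where

  x : ℕ → ℤ
  x = xAt xs

  t : ℕ
  t = length xs

  x0≡0 : x 0 ≡ 0ℤ
  x0≡0 = xAt-zero xs

  0≮x0 : ¬ 0ℤ < x 0
  0≮x0 = ZP.<-irrefl (sym x0≡0)

  x0≮0 : ¬ x 0 < 0ℤ
  x0≮0 = ZP.<-irrefl x0≡0

  prefix : ℕ → List ℕ
  prefix = πPrefix xs

  -- The last element of πPrefix xs q, for every q; π xs q ≡ pick q only for 1 ≤ q ≤ t.
  pick : ℕ → ℕ
  pick zero          = 0
  pick (suc zero)    = 1
  pick (suc (suc k)) = nextπ xs (prefix (suc k))

  prefix-∷ʳ : ∀ k → prefix (suc k) ≡ prefix k ∷ʳ pick (suc k)
  prefix-∷ʳ zero    = refl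
  prefix-∷ʳ (suc k) = refl

  prefix≡map-pick : ∀ k → prefix k ≡ map pick (range1 k)
  prefix≡map-pick zero    = refl
  prefix≡map-pick (suc k) = begin
    prefix (suc k)                      ≡⟨ prefix-∷ʳ k ⟩
    prefix k ∷ʳ pick (suc k)            ≡⟨ cong (_∷ʳ pick (suc k)) (prefix≡map-pick k) ⟩
    map pick (range1 k) ∷ʳ pick (suc k) ≡⟨ map-++ pick (range1 k) (suc k ∷ []) ⟨
    map pick (range1 k ∷ʳ suc k)        ≡⟨ cong (map pick) (range1-∷ʳ k) ⟨
    map pick (range1 (suc k))           ∎
    where open ≡-Reasoning

  ∈-prefix⁺ : ∀ {k l} → 1 ≤ l → l ≤ k → pick l ∈ prefix k
  ∈-prefix⁺ {k} 1≤l l≤k =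
    subst (_ ∈_) (sym (prefix≡map-pick k)) (∈-map⁺ pick (∈-range1⁺ 1≤l l≤k))

  ∈-prefix⁻ : ∀ {k j} → j ∈ prefix k → ∃ λ l → 1 ≤ l × l ≤ k × pick l ≡ j
  ∈-prefix⁻ {k} j∈ with l , l∈ , refl ← ∈-map⁻ pick (subst (_ ∈_) (prefix≡map-pick k) j∈) =
    let 1≤l , l≤k = ∈-range1⁻ l∈ in l , 1≤l , l≤k , refl

  prefix-⊆ : ∀ {k m j} → k ≤ m → j ∈ prefix k → j ∈ prefix m
  prefix-⊆ k≤m j∈ with l , 1≤l , l≤k , refl ← ∈-prefix⁻ j∈ = ∈-prefix⁺ 1≤l (≤-trans l≤k k≤m)

  length-prefix : ∀ k → length (prefix k) ≡ k
  length-prefix k = begin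
    length (prefix k)              ≡⟨ cong length (prefix≡map-pick k) ⟩
    length (map pick (range1 k))   ≡⟨ length-map pick (range1 k) ⟩
    length (map suc (upTo k))      ≡⟨ length-map suc (upTo k) ⟩
    length (upTo k)                ≡⟨ length-upTo k ⟩
    k                              ∎
    where open ≡-Reasoning

  nthℕ-prefix : ∀ {n q} → 1 ≤ q → q ≤ n → nthℕ (prefix n) q ≡ pick q
  nthℕ-prefix {zero}  1≤q q≤0 = contradiction (≤-trans 1≤q q≤0) λ ()
  nthℕ-prefix {suc n} {q} 1≤q q≤1+n with m≤n⇒m<n∨m≡n q≤1+n
  ... | inj₁ q<1+n = begin
    nthℕ (prefix (suc n)) q           ≡⟨ cong (λ l → nthℕ l q) (prefix-∷ʳ n) ⟩
    nthℕ (prefix n ∷ʳ pick (suc n)) q ≡⟨ nthℕ-∷ʳ-< (prefix n) _ 1≤q q≤length ⟩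
    nthℕ (prefix n) q                 ≡⟨ nthℕ-prefix 1≤q (≤-pred q<1+n) ⟩
    pick q                            ∎
    where
    open ≡-Reasoning
    q≤length : q ≤ length (prefix n)
    q≤length = subst (q ≤_) (sym (length-prefix n)) (≤-pred q<1+n)
  ... | inj₂ refl = begin
    nthℕ (prefix (suc n)) (suc n)
      ≡⟨ cong (λ l → nthℕ l (suc n)) (prefix-∷ʳ n) ⟩
    nthℕ (prefix n ∷ʳ pick (suc n)) (suc n)
      ≡⟨ cong (λ m → nthℕ (prefix n ∷ʳ pick (suc n)) (suc m)) (length-prefix n) ⟨
    nthℕ (prefix n ∷ʳ pick (suc n)) (suc (length (prefix n)))
      ≡⟨ nthℕ-∷ʳ-length (prefix n) _ ⟩
    pick (suc n)
      ∎
    where open ≡-Reasoning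

  π≡pick : ∀ {q} → 1 ≤ q → q ≤ t → π xs q ≡ pick q
  π≡pick = nthℕ-prefix

  negative-π⇒negative-pick : ∀ {h} → x (π xs h) < 0ℤ → 1 ≤ h × h ≤ t × x (pick h) < 0ℤ
  negative-π⇒negative-pick {h} neg =
    let 1≤h , h≤length = nthℕ-support (prefix t) λ π≡0 → x0≮0 (subst (λ j → x j < 0ℤ) π≡0 neg)
        h≤t            = subst (h ≤_) (length-prefix t) h≤length
    in 1≤h , h≤t , subst (λ j → x j < 0ℤ) (π≡pick 1≤h h≤t) neg

  positive-pick-range : ∀ q → 0ℤ < x (pick q) → 1 ≤ pick q × pick q ≤ t
  positive-pick-range _ pos = xAt-support xs (ZP.<⇒≢ pos ∘ sym)

  S : ℕ → ℤ
  S k = sumℤ (map x (prefix k))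

  S-suc : ∀ k → S (suc k) ≡ S k + x (pick (suc k))
  S-suc k = begin
    sumℤ (map x (prefix (suc k)))               ≡⟨ cong (sumℤ ∘ map x) (prefix-∷ʳ k) ⟩
    sumℤ (map x (prefix k ∷ʳ pick (suc k)))     ≡⟨ cong sumℤ (map-++ x (prefix k) (pick (suc k) ∷ [])) ⟩
    sumℤ (map x (prefix k) ∷ʳ x (pick (suc k))) ≡⟨ sumℤ-∷ʳ (map x (prefix k)) (x (pick (suc k))) ⟩
    S k + x (pick (suc k))                      ∎
    where open ≡-Reasoning

  Σ1to-π≡S : ∀ {h} → h ≤ t → Σ1to h (x ∘ π xs) ≡ S h
  Σ1to-π≡S {zero}  _   = refl
  Σ1to-π≡S {suc h} h<t = begin
    Σ1to (suc h) (x ∘ π xs)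
      ≡⟨ Σ1to-suc h (x ∘ π xs) ⟩
    Σ1to h (x ∘ π xs) + x (π xs (suc h))
      ≡⟨ cong₂ _+_ (Σ1to-π≡S (<⇒≤ h<t)) (cong x (π≡pick (s≤s z≤n) h<t)) ⟩
    S h + x (pick (suc h))
      ≡⟨ S-suc h ⟨
    S (suc h)
      ∎
    where open ≡-Reasoning

  S-antitone : ∀ {a b} → a ≤ b → (∀ {k} → a ℕ.< k → k ≤ b → x (pick k) ℤ.≤ 0ℤ) → S b ℤ.≤ S a
  S-antitone a≤b nonpos =
    chain-by-steps (λ u v → v ℤ.≤ u) ZP.≤-refl (λ u≥v v≥w → ZP.≤-trans v≥w u≥v) S step a≤b
    where
    step : ∀ {k} → _ ≤ k → k ℕ.< _ → S (suc k) ℤ.≤ S k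
    step {k} a≤k k<b = subst (ℤ._≤ S k) (sym (S-suc k)) (+-nonpos-≤ (S k) (nonpos (s≤s a≤k) k<b))

  usedᵇ : ℕ → ℕ → Bool
  usedᵇ k j = any (λ u → ⌊ u ℕ.≟ j ⌋) (prefix k)

  available : (ℤ → Bool) → ℕ → ℕ → Bool
  available p k j = not (usedᵇ k j) ∧ p (x j)

  first : (ℤ → Bool) → ℕ → Maybe ℕ
  first p k = firstUnused xs p (prefix k)

  usedᵇ⇔∈ : ∀ {k j} → T (usedᵇ k j) ⇔ j ∈ prefix k
  usedᵇ⇔∈ = mk⇔ (Any.map (sym ∘ toWitness) ∘ any⁻ _ _) (any⁺ _ ∘ Any.map (fromWitness ∘ sym))

  available⁻ : ∀ p k j → T (available p k j) → j ∉ prefix k × T (p (x j))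
  available⁻ p k j a with usedᵇ k j in e
  ... | false = (λ j∈ → subst T e (Equivalence.from (usedᵇ⇔∈ {k} {j}) j∈)) , a

  available⁺ : ∀ p k j → j ∉ prefix k → T (p (x j)) → T (available p k j)
  available⁺ p k j j∉ pj with usedᵇ k j in e
  ... | false = pj
  ... | true  = j∉ (Equivalence.to (usedᵇ⇔∈ {k} {j}) (subst T (sym e) _))

  available-antitone : ∀ p {k m} j → k ≤ m → T (available p m j) → T (available p k j)
  available-antitone p {k} {m} j k≤m a =
    let j∉ , pj = available⁻ p m j a in available⁺ p k j (j∉ ∘ prefix-⊆ k≤m) pj

  available-suc : ∀ p k j → T (available p k j) → pick (suc k) ≢ j → T (available p (suc k) j)
  available-suc p k j a pick≢j with j∉ , pj ← available⁻ p k j a = available⁺ p (suc k) j j∉′ pj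
    where
    j∉′ : j ∉ prefix (suc k)
    j∉′ j∈ with ∈-++⁻ (prefix k) (subst (j ∈_) (prefix-∷ʳ k) j∈)
    ... | inj₁ j∈k         = j∉ j∈k
    ... | inj₂ (here refl) = pick≢j refl

  first-least : ∀ p k {s} → first p k ≡ just s → Least (available p k) t s
  first-least p k e with found l ← firstIn-≡ {available p k} {t} e = l

  first-negative : ∀ k {s} → first isNeg k ≡ just s → x s < 0ℤ
  first-negative k e = toWitness (proj₂ (available⁻ isNeg k _ (Least.holds (first-least isNeg k e))))

  first-positive : ∀ k {s} → first isPos k ≡ just s → 0ℤ < x s
  first-positive k e = toWitness (proj₂ (available⁻ isPos k _ (Least.holds (first-least isPos k e))))

  first-nothing-persists : ∀ p k → first p k ≡ nothing → first p (suc k) ≡ nothing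
  first-nothing-persists p k = head-filterᵇ-range1-⊆-nothing {available p k} {available p (suc k)} {t}
    λ {j} → available-antitone p j (n≤1+n k)

  first-persists : ∀ p k {s} → first p k ≡ just s → pick (suc k) ≢ s → first p (suc k) ≡ just s
  first-persists p k {s} e pick≢s =
    head-filterᵇ-range1-⊆-just {available p k} {available p (suc k)} {t}
      (λ {j} → available-antitone p j (n≤1+n k)) e
      (available-suc p k s (Least.holds (first-least p k e)) pick≢s)

  data Step (k : ℕ) : ℕ → Set where
    takesNegative : ∀ {s} → first isNeg k ≡ just s → 0ℤ ℤ.≤ S k + x s → Step k s
    takesPositive : ∀ {s s′} → first isNeg k ≡ just s → S k + x s < 0ℤ →
                    first isPos k ≡ just s′ → Step k s′
    stuck         : ∀ {s} → first isNeg k ≡ just s → S k + x s < 0ℤ →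
                    first isPos k ≡ nothing → Step k 0
    onlyPositives : ∀ {s′} → first isNeg k ≡ nothing → first isPos k ≡ just s′ → Step k s′
    exhausted     : first isNeg k ≡ nothing → first isPos k ≡ nothing → Step k 0

  step : ∀ k → Step k (nextπ xs (prefix k))
  step k with firstUnused xs isNeg (prefix k) in eN | firstUnused xs isPos (prefix k) in eP
  ... | just s | _ with 0ℤ ℤ.≤? (sumℤ (map (xAt xs) (prefix k)) + xAt xs s)
  ...   | yes fits = takesNegative eN fits
  step k | just s  | just _  | no misfit = takesPositive eN (ZP.≰⇒> misfit) eP
  step k | just s  | nothing | no misfit = stuck eN (ZP.≰⇒> misfit) eP
  step k | nothing | just _  = onlyPositives eN eP
  step k | nothing | nothing = exhausted eN eP

  step-at : ∀ {k} → 1 ≤ k → Step k (pick (suc k))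
  step-at {suc k} _ = step (suc k)

  NegativesBlocked : ℕ → Set
  NegativesBlocked k = first isNeg k ≡ nothing
                     ⊎ ∃ λ s → first isNeg k ≡ just s × S k + x s < 0ℤ × first isPos k ≡ nothing

  stuck-pick≡0 : ∀ {k r s} → Step k r → first isNeg k ≡ just s → S k + x s < 0ℤ →
    first isPos k ≡ nothing → r ≡ 0
  stuck-pick≡0 (takesNegative eN′ fits) eN misfit _  with refl ← trans (sym eN) eN′ =
    contradiction fits (ZP.<⇒≱ misfit)
  stuck-pick≡0 (takesPositive _ _ eP′)  _  _      eP with () ← trans (sym eP) eP′
  stuck-pick≡0 (stuck _ _ _)            _  _      _  = refl
  stuck-pick≡0 (onlyPositives eN′ _)    eN _      _  with () ← trans (sym eN) eN′
  stuck-pick≡0 (exhausted _ _)          _  _      _  = refl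

  negativesBlocked-suc : ∀ {k} → 1 ≤ k → NegativesBlocked k → NegativesBlocked (suc k)
  negativesBlocked-suc {k} _   (inj₁ eN) = inj₁ (first-nothing-persists isNeg k eN)
  negativesBlocked-suc {k} 1≤k (inj₂ (s , eN , misfit , eP)) =
    inj₂ ( s , first-persists isNeg k eN pick≢s , subst (λ z → z + x s < 0ℤ) (sym S-same) misfit
         , first-nothing-persists isPos k eP )
    where
    pick≡0 : pick (suc k) ≡ 0
    pick≡0 = stuck-pick≡0 (step-at 1≤k) eN misfit eP
    pick≢s : pick (suc k) ≢ s
    pick≢s e = contradiction (Least.lower (first-least isNeg k eN))
                             (subst (λ z → ¬ 1 ≤ z) (trans (sym pick≡0) e) λ ())
    S-same : S (suc k) ≡ S k
    S-same = begin
      S (suc k)              ≡⟨ S-suc k ⟩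
      S k + x (pick (suc k)) ≡⟨ cong (λ z → S k + x z) pick≡0 ⟩
      S k + x 0              ≡⟨ cong (S k +_) x0≡0 ⟩
      S k + 0ℤ               ≡⟨ ZP.+-identityʳ (S k) ⟩
      S k                    ∎
      where open ≡-Reasoning

  negativesBlocked⇒pick≮0 : ∀ {k} → 1 ≤ k → NegativesBlocked k → ¬ x (pick (suc k)) < 0ℤ
  negativesBlocked⇒pick≮0 {k} 1≤k (inj₂ (_ , eN , misfit , eP))
    rewrite stuck-pick≡0 (step-at 1≤k) eN misfit eP = x0≮0
  negativesBlocked⇒pick≮0 {k} 1≤k (inj₁ eN) with pick (suc k) | step-at 1≤k
  ... | _ | takesNegative eN′ _   with () ← trans (sym eN) eN′
  ... | _ | takesPositive eN′ _ _ with () ← trans (sym eN) eN′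
  ... | _ | stuck eN′ _ _         with () ← trans (sym eN) eN′
  ... | _ | onlyPositives _ eP    = ZP.<-asym (first-positive k eP)
  ... | _ | exhausted _ _         = x0≮0

  negativesBlocked⇒no-later-negative : ∀ {k q} → 1 ≤ k → NegativesBlocked k → k ℕ.< q →
    ¬ x (pick q) < 0ℤ
  negativesBlocked⇒no-later-negative {k} {suc q} 1≤k blocked k<1+q =
    negativesBlocked⇒pick≮0 (≤-trans 1≤k k≤q)
      (chain-by-steps (λ P Q → P → Q) id (λ f g → g ∘ f) NegativesBlocked
        (λ k≤m _ → negativesBlocked-suc (≤-trans 1≤k k≤m)) k≤q blocked)
    where
    k≤q : k ≤ q
    k≤q = ≤-pred k<1+q

  negative-pick⇒S-nonneg : ∀ {h} → 2 ≤ h → x (pick h) < 0ℤ → 0ℤ ℤ.≤ S h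
  negative-pick⇒S-nonneg {suc k} (s≤s 1≤k) neg =
    subst (0ℤ ℤ.≤_) (sym (S-suc k)) (fits (step-at 1≤k) neg)
    where
    fits : ∀ {r} → Step k r → x r < 0ℤ → 0ℤ ℤ.≤ S k + x r
    fits (takesNegative _ fits) _   = fits
    fits (takesPositive _ _ eP) neg = contradiction (first-positive k eP) (ZP.<-asym neg)
    fits (stuck _ _ _)          neg = contradiction neg x0≮0
    fits (onlyPositives _ eP)   neg = contradiction (first-positive k eP) (ZP.<-asym neg)
    fits (exhausted _ _)        neg = contradiction neg x0≮0

  positive-pick⇒first : ∀ {k} → 1 ≤ k → 0ℤ < x (pick (suc k)) →
    first isPos k ≡ just (pick (suc k))
  positive-pick⇒first {k} 1≤k pos with pick (suc k) | step-at 1≤k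
  ... | _ | takesNegative eN _   = contradiction (first-negative k eN) (ZP.<-asym pos)
  ... | _ | takesPositive _ _ eP = eP
  ... | _ | stuck _ _ _          = contradiction pos 0≮x0
  ... | _ | onlyPositives _ eP   = eP
  ... | _ | exhausted _ _        = contradiction pos 0≮x0

  nonpositive-pick⇒first-negative : ∀ {k q} → 1 ≤ k → ¬ 0ℤ < x (pick (suc k)) →
    k ℕ.< q → x (pick q) < 0ℤ → first isNeg k ≡ just (pick (suc k))
  nonpositive-pick⇒first-negative {k} 1≤k ¬pos k<q neg with pick (suc k) | step-at 1≤k
  ... | _ | takesNegative eN _   = eN
  ... | _ | takesPositive _ _ eP = contradiction (first-positive k eP) ¬pos
  ... | _ | onlyPositives _ eP   = contradiction (first-positive k eP) ¬pos
  ... | _ | stuck eN misfit eP   =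
    contradiction neg (negativesBlocked⇒no-later-negative 1≤k (inj₂ (_ , eN , misfit , eP)) k<q)
  ... | _ | exhausted eN _       =
    contradiction neg (negativesBlocked⇒no-later-negative 1≤k (inj₁ eN) k<q)

  S-after-positive : ∀ {p q} → 1 ≤ p → 0ℤ < x (pick p) → ¬ 0ℤ < x (pick (suc p)) →
    p ℕ.< q → x (pick q) < 0ℤ → S (suc p) < x (pick p)
  S-after-positive {1} _ _ ¬pos p<q neg = begin-strict
    S 2              ≡⟨ S-suc 1 ⟩
    S 1 + x (pick 2) <⟨ +-neg-< (S 1) (first-negative 1 first≡) ⟩
    x 1 + 0ℤ         ≡⟨ ZP.+-identityʳ (x 1) ⟩
    x 1              ∎
    where
    open ZP.≤-Reasoning
    first≡ : first isNeg 1 ≡ just (pick 2)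
    first≡ = nonpositive-pick⇒first-negative ≤-refl ¬pos p<q neg
  S-after-positive {suc k@(suc _)} {q} _ pos ¬pos′ p<q neg = after (step-at (s≤s z≤n)) refl pos
    where
    after : ∀ {r} → Step k r → r ≡ pick (suc k) → 0ℤ < x r → S (suc (suc k)) < x (pick (suc k))
    after (takesNegative eN _) _ pos = contradiction pos (ZP.<-asym (first-negative k eN))
    after (stuck _ _ _)        _ pos = contradiction pos 0≮x0
    after (exhausted _ _)      _ pos = contradiction pos 0≮x0
    after (onlyPositives eN _) _ _   =
      contradiction neg (negativesBlocked⇒no-later-negative (s≤s z≤n) (inj₁ eN) (<-trans (n<1+n k) p<q))
    after (takesPositive {s} eN misfit _) refl pos = begin-strict
      S (suc (suc k))                    ≡⟨ S-suc (suc k) ⟩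
      S (suc k) + x (pick (suc (suc k))) ≡⟨ cong₂ (λ u v → u + x v) (S-suc k) pick≡s ⟩
      (S k + x (pick (suc k))) + x s     ≡⟨ xy∙z≈xz∙y (S k) (x (pick (suc k))) (x s) ⟩
      (S k + x s) + x (pick (suc k))     <⟨ ZP.+-monoˡ-< (x (pick (suc k))) misfit ⟩
      0ℤ + x (pick (suc k))              ≡⟨ ZP.+-identityˡ (x (pick (suc k))) ⟩
      x (pick (suc k))                   ∎
      where
      open ZP.≤-Reasoning
      s-persists : first isNeg (suc k) ≡ just s
      s-persists = first-persists isNeg k eN λ e →
        ZP.<-asym pos (subst (λ z → x z < 0ℤ) (sym e) (first-negative k eN))
      pick≡s : pick (suc (suc k)) ≡ s
      pick≡s = just-injective
        (trans (sym (nonpositive-pick⇒first-negative (s≤s z≤n) ¬pos′ p<q neg)) s-persists)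

  S-below-last-positive : ∀ {g h p} → 1 ≤ g → Greatest (λ k → 0ℤ < x (pick k)) g h p →
    x (pick h) < 0ℤ → S h < x (pick p)
  S-below-last-positive {g} {h} {p} 1≤g G neg = ZP.≤-<-trans
    (S-antitone upper λ 1+p<k k≤h → ZP.≮⇒≥ (¬positive-after (<-trans (n<1+n p) 1+p<k) k≤h))
    (S-after-positive (≤-trans 1≤g lower) holds (¬positive-after ≤-refl upper) upper neg)
    where
    open Greatest G
    ¬positive-after : ∀ {k} → p ℕ.< k → k ≤ h → ¬ 0ℤ < x (pick k)
    ¬positive-after p<k k≤h with m≤n⇒m<n∨m≡n k≤h
    ... | inj₁ k<h  = maximal p<k k<h
    ... | inj₂ refl = ZP.<-asym neg

  pick-positive-monotone : ∀ {a b} → 1 ≤ a → a ≤ b → 0ℤ < x (pick a) → 0ℤ < x (pick b) →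
    pick a ≤ pick b
  pick-positive-monotone {1} {b} _ _ _ posb = proj₁ (positive-pick-range b posb)
  pick-positive-monotone {suc k@(suc _)} {suc m} _ a≤b posa posb =
    ≮⇒≥ λ pb<pa → minimal (proj₁ (positive-pick-range (suc m) posb)) pb<pa
                    (available-antitone isPos (pick (suc m)) (≤-pred a≤b) (Least.holds pb-first))
    where
    open Least (first-least isPos k (positive-pick⇒first {k} (s≤s z≤n) posa))
    pb-first : Least (available isPos m) t (pick (suc m))
    pb-first = first-least isPos m (positive-pick⇒first {m} (≤-trans (s≤s z≤n) (≤-pred a≤b)) posb)

  picked-up-to : ∀ {p j} → 1 ≤ p → 0ℤ < x (pick p) → 1 ≤ j → j ≤ pick p → 0ℤ < x j →
    ∃ λ l → 1 ≤ l × l ≤ p × pick l ≡ j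
  picked-up-to {p} {j} 1≤p posp 1≤j j≤pp posj with m≤n⇒m<n∨m≡n j≤pp
  ... | inj₂ refl = p , 1≤p , ≤-refl , refl
  ... | inj₁ j<pp with p
  ...   | 1 = contradiction (<-≤-trans j<pp 1≤j) (<-irrefl refl)
  ...   | suc k@(suc _) with j ∈? prefix k
  ...     | yes j∈ = let l , 1≤l , l≤k , e = ∈-prefix⁻ j∈ in l , 1≤l , m≤n⇒m≤1+n l≤k , e
  ...     | no j∉  = contradiction (available⁺ isPos k j j∉ (fromWitness posj)) (minimal 1≤j j<pp)
    where open Least (first-least isPos k (positive-pick⇒first {k} (s≤s z≤n) posp))

  γ-in-run : ∀ {i} → γ xs (suc i) ≤ t → 1 ≤ γ xs (suc i) × InUpRun xs i (pick (γ xs (suc i)))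
  γ-in-run {i} γ≤t =
    lower , Equivalence.to (inUᵇ⇔InUpRun xs) (subst (T ∘ inUᵇ xs (suc i)) (π≡pick lower upper) holds)
    where open Least (γ-least xs (suc i) γ≤t)

  last-positive-stays-in-run : ∀ {y i g p h} → 0ℤ < x 1 → numRuns xs ≡ 2 * y → suc i ≤ y →
    (suc i ℕ.< y → h ℕ.< γ xs (suc (suc i))) → 1 ≤ g → g ≤ p → p ℕ.< h → h ≤ t →
    InUpRun xs i (pick g) → 0ℤ < x (pick p) → InUpRun xs i (pick p)
  last-positive-stays-in-run {y} {i} {g} {p} {h} x₁>0 runs 1+i≤y before-next 1≤g g≤p p<h h≤t g∈ posp
    with next-up-run xs x₁>0 g∈ (pick-positive-monotone 1≤g g≤p (InUpRun.positive g∈) posp)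
                     (proj₂ (positive-pick-range p posp)) posp
  ... | inj₁ p∈ = p∈
  ... | inj₂ (j , _ , j≤pp , j∈)
    with l , 1≤l , l≤p , pick≡j ← picked-up-to (≤-trans 1≤g g≤p) posp
                                     (InUpRun.lower j∈) j≤pp (InUpRun.positive j∈)
       | m≤n⇒m<n∨m≡n 1+i≤y
  ...   | inj₂ refl = contradiction j∈ (no-up-run-beyond xs runs)
  ...   | inj₁ 1+i<y =
    contradiction (before-next 1+i<y) (≤⇒≯ (≤-trans γ≤l (≤-trans l≤p (<⇒≤ p<h))))
    where
    l≤t : l ≤ t
    l≤t = ≤-trans l≤p (≤-trans (<⇒≤ p<h) h≤t)
    γ≤l : γ xs (suc (suc i)) ≤ l
    γ≤l = γ-minimal xs (suc (suc i)) 1≤l l≤t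
            (subst (T ∘ inUᵇ xs (suc (suc i))) (sym (trans (π≡pick 1≤l l≤t) pick≡j))
                   (Equivalence.from (inUᵇ⇔InUpRun xs) j∈))

proposition2p7 : (xs : List ℤ) (y : ℕ) → IsGenCatalan xs → numRuns xs ≡ 2 * y
    → (i : ℕ) → 1 ≤ i → i ≤ y → (h : ℕ) → InΦ xs y i h
    → xAt xs (π xs h) < 0ℤ
    → Data.Integer._≤_ 0ℤ (Σ1to h (λ k → xAt xs (π xs k))) × Σ1to h (λ k → xAt xs (π xs k)) < α xs i
proposition2p7 xs y catalan runs (suc i) _ i≤y h (γ≤h , before-next , _) neg =
  let open Picking xs
      1≤h , h≤t , neg′ = negative-π⇒negative-pick neg
      1≤g , g∈         = γ-in-run (≤-trans γ≤h h≤t)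
      g<h              = ≤∧≢⇒< γ≤h λ { refl → ZP.<-asym neg′ (InUpRun.positive g∈) }
      p , last         = greatest (λ k → 0ℤ ℤ.<? x (pick k)) g<h (InUpRun.positive g∈)
      open Greatest last
      p∈               = last-positive-stays-in-run (catalan-head-positive xs catalan (≤-trans 1≤h h≤t))
                           runs i≤y before-next 1≤g lower upper h≤t g∈ holds
      Σ≡S              = Σ1to-π≡S h≤t
  in subst (0ℤ ℤ.≤_) (sym Σ≡S) (negative-pick⇒S-nonneg (≤-trans (s≤s 1≤g) g<h) neg′) ,
     subst (_< α xs (suc i)) (sym Σ≡S) (ZP.<-≤-trans (S-below-last-positive 1≤g last neg′) (≤-α xs p∈))
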